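{- Let $G\in\mathbb{R}^{n\times n}$, $z\in\mathbb{R}^n$, and let $x\in\mathbb{R}^n$ satisfy $x=Gx+z$. Fix $i$, initialize $\hat{x}_i=0$ and $r=e_i$, and apply any finite sequence of asynchronous coordinate-update tasks. Then after every task, $x_i=\hat{x}_i+r^Tx$.
   Context: An asynchronous update task on coordinate $u\in\{1,\dots,n\}$ transforms $(\hat{x}_i,r)$ into $(\hat{x}_i^{new},r^{new})$ by: $\hat{x}_i^{new}=\hat{x}_i+r_uz_u$; $r^{new}_u=G_{uu}r_u$; $r^{new}_v=r_v+G_{uv}r_u$ for every $v\ne u$ (this changes only $v$ with $G_{uv}\neq0$). Equivalently $r^{new}=r-(I-G^T)e_u r_u$. Here $e_u$ is the $u$-th standard basis vector. -}

module Defs where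

open import Level using (Level)
open import Algebra.Bundles using (CommutativeRing)
open import Data.Nat using (ℕ)
open import Data.Fin using (Fin; _≟_)
open import Data.List using (List; []; _∷_)
open import Data.Product using (_×_; _,_)
open import Relation.Nullary using (yes; no)
import Algebra.Definitions.RawMonoid as RM

-- Matrices/vectors over a commutative ring R (stand-in for ℝ):
-- a vector in R^n is  Fin n → Carrier,  a matrix in R^{n×n} is  Fin n → Fin n → Carrier.
module Async {c ℓ : Level} (R : CommutativeRing c ℓ) where
  open CommutativeRing R

  Vec : ℕ → Set c
  Vec n = Fin n → Carrier

  Mat : ℕ → Set c
  Mat n = Fin n → Fin n → Carrier

  sum : ∀ {n} → Vec n → Carrier
  sum = RM.sum +-rawMonoid

  dot : ∀ {n} → Vec n → Vec n → Carrier
  dot r x = sum (λ v → r v * x v)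

  IsFixedPoint : ∀ {n} → Mat n → Vec n → Vec n → Set ℓ
  IsFixedPoint {n} G z x = ∀ (i : Fin n) → x i ≈ sum (λ j → G i j * x j) + z i

  e : ∀ {n} → Fin n → Vec n
  e i v with v ≟ i
  ... | yes _ = 1#
  ... | no  _ = 0#

  -- algorithm state: (x̂_i , r)
  State : ℕ → Set c
  State n = Carrier × Vec n

  task : ∀ {n} → Mat n → Vec n → Fin n → State n → State n
  task G z u (xh , r) = (xh + r u * z u , r′)
    where
    r′ : Vec _
    r′ v with v ≟ u
    ... | yes _ = G u u * r u
    ... | no  _ = r v + G u v * r u

  init : ∀ {n} → Fin n → State n
  init i = (0# , e i)

  run : ∀ {n} → Mat n → Vec n → List (Fin n) → State n → State n
  run G z []       s = s
  run G z (u ∷ us) s = run G z us (task G z u s)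

module Submission where

-- A task on coordinate u adds r_u z_u to x̂_i and replaces the residual r by
-- r − r_u c_u, where c_u = (I − Gᵀ) e_u, i.e. (c_u)_v = (e_u)_v − G_uv.
-- Since rᵀx is linear in r, the task changes rᵀx by −r_u (c_uᵀ x), and
-- c_uᵀ x = x_u − (Gx)_u = z_u precisely because x = Gx + z.  The two changes
-- cancel, so every task preserves the invariant; the initial state
-- (x̂_i , r) = (0 , e_i) satisfies it because e_iᵀ x = x_i.

open import Defs
open import Level using (Level)
open import Algebra.Bundles using (CommutativeRing)
open import Data.Nat using (ℕ; suc)
open import Data.Fin using (Fin; _≟_; punchIn)
open import Data.Fin.Properties using (punchInᵢ≢i)
open import Data.List using (List; []; _∷_)
open import Data.Product using (proj₁; proj₂; _,_)
open import Relation.Binary.PropositionalEquality using (_≢_) renaming (refl to ≡-refl)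
open import Relation.Nullary using (yes; no; contradiction)
import Relation.Binary.Reasoning.Setoid as SetoidReasoning
import Algebra.Properties.Ring as RingProperties
import Algebra.Properties.Semiring.Sum as SemiringSum

module Invariant {c ℓ : Level} (R : CommutativeRing c ℓ) where
  open CommutativeRing R
  open Async R
  open RingProperties ring
    using (-1*x≈-x; ⁻¹-anti-homo‿-; xyx⁻¹≈y; x[y-z]≈xy-xz; -‿distribʳ-*; -‿involutive; [y-z]x≈yx-zx)
  open SemiringSum semiring
    using (sum-cong-≋; ∑-distrib-+; *-distribˡ-sum; sum-remove; sum-replicate-zero)
  open SetoidReasoning setoid

  -- Diagonal entry of a task: the new r_u = G_uu r_u equals r_u − r_u (1 − G_uu).
  diagonal-identity : ∀ a g → g * a ≈ a - a * (1# - g)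
  diagonal-identity a g = sym (begin
    a - a * (1# - g)        ≈⟨ +-congˡ (-‿cong (x[y-z]≈xy-xz a 1# g)) ⟩
    a - (a * 1# - a * g)    ≈⟨ +-congˡ (-‿cong (+-congʳ (*-identityʳ a))) ⟩
    a - (a - a * g)         ≈⟨ +-congˡ (⁻¹-anti-homo‿- a (a * g)) ⟩
    a + (a * g - a)         ≈⟨ sym (+-assoc a (a * g) (- a)) ⟩
    a + a * g - a           ≈⟨ xyx⁻¹≈y a (a * g) ⟩
    a * g                   ≈⟨ *-comm a g ⟩
    g * a                   ∎)

  -- Off-diagonal entry of a task: r_v + G_uv r_u equals r_v − r_u (0 − G_uv).
  offDiagonal-identity : ∀ b a g → b + g * a ≈ b - a * (0# - g)
  offDiagonal-identity b a g = sym (begin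
    b - a * (0# - g)        ≈⟨ +-congˡ (-‿cong (*-congˡ (+-identityˡ (- g)))) ⟩
    b - a * - g             ≈⟨ +-congˡ (-‿cong (sym (-‿distribʳ-* a g))) ⟩
    b - - (a * g)           ≈⟨ +-congˡ (-‿involutive (a * g)) ⟩
    b + a * g               ≈⟨ +-congˡ (*-comm a g) ⟩
    b + g * a               ∎)

  -- What a task adds to x̂_i is exactly what it removes from rᵀx.
  exchange-identity : ∀ h d a → h + d ≈ (h + a) + (d - a)
  exchange-identity h d a = sym (begin
    (h + a) + (d - a)       ≈⟨ +-congʳ (+-comm h a) ⟩
    (a + h) + (d - a)       ≈⟨ +-assoc a h (d - a) ⟩
    a + (h + (d - a))       ≈⟨ +-congˡ (sym (+-assoc h d (- a))) ⟩
    a + (h + d - a)         ≈⟨ sym (+-assoc a (h + d) (- a)) ⟩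
    a + (h + d) - a         ≈⟨ xyx⁻¹≈y a (h + d) ⟩
    h + d                   ∎)

  sum-neg : ∀ {n} (f : Vec n) → sum (λ v → - f v) ≈ - sum f
  sum-neg f = begin
    sum (λ v → - f v)       ≈⟨ sum-cong-≋ (λ v → sym (-1*x≈-x (f v))) ⟩
    sum (λ v → - 1# * f v)  ≈⟨ sym (*-distribˡ-sum (- 1#) f) ⟩
    - 1# * sum f            ≈⟨ -1*x≈-x (sum f) ⟩
    - sum f                 ∎

  sum-sub : ∀ {n} (f g : Vec n) → sum (λ v → f v - g v) ≈ sum f - sum g
  sum-sub f g = trans (∑-distrib-+ f (λ v → - g v)) (+-congˡ (sum-neg g))

  dot-cong : ∀ {n} {r s : Vec n} (x : Vec n) → (∀ v → r v ≈ s v) → dot r x ≈ dot s x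
  dot-cong x r≈s = sum-cong-≋ (λ v → *-congʳ (r≈s v))

  dot-sub : ∀ {n} (r s x : Vec n) → dot (λ v → r v - s v) x ≈ dot r x - dot s x
  dot-sub r s x = trans (sum-cong-≋ (λ v → [y-z]x≈yx-zx (x v) (r v) (s v)))
                        (sum-sub (λ v → r v * x v) (λ v → s v * x v))

  dot-scale : ∀ {n} (a : Carrier) (r x : Vec n) → dot (λ v → a * r v) x ≈ a * dot r x
  dot-scale a r x = trans (sum-cong-≋ (λ v → *-assoc a (r v) (x v)))
                          (sym (*-distribˡ-sum a (λ v → r v * x v)))

  e-on : ∀ {n} (u : Fin n) → e u u ≈ 1#
  e-on u with u ≟ u
  ... | yes _   = refl
  ... | no u≢u  = contradiction ≡-refl u≢u

  e-off : ∀ {n} (u v : Fin n) → v ≢ u → e u v ≈ 0#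
  e-off u v v≢u with v ≟ u
  ... | yes v≡u = contradiction v≡u v≢u
  ... | no _    = refl

  dot-e : ∀ {n} (i : Fin n) (x : Vec n) → dot (e i) x ≈ x i
  dot-e {suc n} i x = begin
    dot (e i) x
      ≈⟨ sum-remove {i = i} (λ v → e i v * x v) ⟩
    e i i * x i + sum {n} (λ j → e i (punchIn i j) * x (punchIn i j))
      ≈⟨ +-cong (*-congʳ (e-on i)) (sum-cong-≋ others-vanish) ⟩
    1# * x i + sum {n} (λ _ → 0#)
      ≈⟨ +-cong (*-identityˡ (x i)) (sum-replicate-zero n) ⟩
    x i + 0#
      ≈⟨ +-identityʳ (x i) ⟩
    x i ∎
    where
    others-vanish : ∀ j → e i (punchIn i j) * x (punchIn i j) ≈ 0#
    others-vanish j = trans (*-congʳ (e-off i (punchIn i j) (punchInᵢ≢i i j)))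
                            (zeroˡ (x (punchIn i j)))

  module _ {n : ℕ} (G : Mat n) (z : Vec n) where

    -- c_u = (I − Gᵀ) e_u, the direction along which a task on u moves r.
    correction : Fin n → Vec n
    correction u v = e u v - G u v

    task-residual : ∀ (s : State n) (u v : Fin n) →
                    proj₂ (task G z u s) v ≈ proj₂ s v - proj₂ s u * correction u v
    task-residual (h , r) u v with v ≟ u
    ... | yes ≡-refl = diagonal-identity (r u) (G u u)
    ... | no _       = offDiagonal-identity (r v) (r u) (G u v)

    task-dot : ∀ (s : State n) (u : Fin n) (x : Vec n) →
               dot (proj₂ (task G z u s)) x ≈ dot (proj₂ s) x - proj₂ s u * dot (correction u) x
    task-dot s u x = begin
      dot (proj₂ (task G z u s)) x                         ≈⟨ dot-cong x (task-residual s u) ⟩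
      dot (λ v → r v - r u * correction u v) x             ≈⟨ dot-sub r (λ v → r u * correction u v) x ⟩
      dot r x - dot (λ v → r u * correction u v) x         ≈⟨ +-congˡ (-‿cong (dot-scale (r u) (correction u) x)) ⟩
      dot r x - r u * dot (correction u) x                 ∎
      where r = proj₂ s

    dot-correction : ∀ {x : Vec n} → IsFixedPoint G z x → ∀ u → dot (correction u) x ≈ z u
    dot-correction {x} fixed u = begin
      dot (correction u) x                   ≈⟨ dot-sub (e u) (G u) x ⟩
      dot (e u) x - Gx                       ≈⟨ +-congʳ (dot-e u x) ⟩
      x u - Gx                               ≈⟨ +-congʳ (fixed u) ⟩
      Gx + z u - Gx                          ≈⟨ xyx⁻¹≈y Gx (z u) ⟩
      z u                                    ∎
      where Gx = dot (G u) x

    Tracks : Vec n → Fin n → State n → Set ℓ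
    Tracks x i s = x i ≈ proj₁ s + dot (proj₂ s) x

    init-tracks : ∀ (x : Vec n) (i : Fin n) → Tracks x i (init i)
    init-tracks x i = sym (trans (+-identityˡ (dot (e i) x)) (dot-e i x))

    task-preserves : ∀ {x : Vec n} → IsFixedPoint G z x →
                     ∀ i u (s : State n) → Tracks x i s → Tracks x i (task G z u s)
    task-preserves {x} fixed i u (h , r) tracks = begin
      x i                                          ≈⟨ tracks ⟩
      h + dot r x                                  ≈⟨ exchange-identity h (dot r x) (r u * z u) ⟩
      (h + r u * z u) + (dot r x - r u * z u)      ≈⟨ +-congˡ (+-congˡ (-‿cong (*-congˡ (sym (dot-correction fixed u))))) ⟩
      (h + r u * z u) + (dot r x - r u * dot (correction u) x)
                                                   ≈⟨ +-congˡ (sym (task-dot (h , r) u x)) ⟩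
      proj₁ (task G z u (h , r)) + dot (proj₂ (task G z u (h , r))) x ∎

    run-preserves : ∀ {x : Vec n} → IsFixedPoint G z x →
                    ∀ i us (s : State n) → Tracks x i s → Tracks x i (run G z us s)
    run-preserves fixed i []       s tracks = tracks
    run-preserves fixed i (u ∷ us) s tracks =
      run-preserves fixed i us (task G z u s) (task-preserves fixed i u s tracks)

lemma1 : ∀ {c ℓ : Level} (R : CommutativeRing c ℓ) (n : ℕ)
           (G : Async.Mat R n) (z x : Async.Vec R n) →
           Async.IsFixedPoint R G z x →
           (i : Fin n) (us : List (Fin n)) →
           CommutativeRing._≈_ R (x i)
             (CommutativeRing._+_ R
               (proj₁ (Async.run R G z us (Async.init R i)))
               (Async.dot R (proj₂ (Async.run R G z us (Async.init R i))) x))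
lemma1 R n G z x fixed i us =
  run-preserves G z fixed i us (init i) (init-tracks G z x i)
  where open Async R using (init)
        open Invariant R
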